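{- For every integer $n \geq 5$, the smallest positive integer $k$ for which there exists a proper edge coloring $f: E(H_n) \to \{1,2,\dots,k\}$ such that all vertices of $H_n$ are distinguished by $f$ is $k = n$.
   Context: The $n$-dimensional hypercube $H_n$ is the graph whose vertices are the binary sequences of length $n$, two vertices being adjacent if the sequences differ in exactly one position; if they differ in position $i$, the edge is said to be of dimension $i$. For a vertex $x$ of $H_n$, let $e_i(x)$ denote the unique edge of dimension $i$ incident to $x$. For an edge coloring $f: E(H_n) \to \{1,\dots,k\}$, the palette at $x$ is the sequence $F(x) = (f(e_1(x)), f(e_2(x)), \dots, f(e_n(x)))$. All vertices are distinguished by $f$ if the palettes of any two distinct vertices are different sequences. An edge coloring is proper if any two edges sharing a vertex receive different colors. -}

module Defs where

open import Data.Nat using (ℕ)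
open import Data.Bool using (Bool; not)
open import Data.Fin using (Fin; _≟_)
open import Data.Vec using (Vec; tabulate; updateAt)
open import Data.Product using (Σ; _×_)
open import Function.Definitions using (Injective)
open import Relation.Binary.PropositionalEquality using (_≡_)

Vertex : ℕ → Set
Vertex n = Vec Bool n

-- The neighbour of x across dimension i (flip the i-th coordinate).
-- The edge e_i(x) is {x , flip i x}; every edge of H_n arises this way,
-- and e_i(x) = e_i(flip i x).
flip : ∀ {n} → Fin n → Vertex n → Vertex n
flip i x = updateAt x i not

-- An edge colouring f : E(H_n) → {1,…,k}, with colours {1..k} encoded as Fin k.
-- It is given by the colour  colour x i  of e_i(x), required to be well defined
-- on edges: e_i(x) and e_i(flip i x) are the same edge.
record EdgeColouring (n k : ℕ) : Set where
  field
    colour    : Vertex n → Fin n → Fin k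
    wellDefd  : ∀ x i → colour x i ≡ colour (flip i x) i
open EdgeColouring public

palette : ∀ {n k} → EdgeColouring n k → Vertex n → Vec (Fin k) n
palette f x = tabulate (colour f x)

-- Proper: edges sharing a vertex get different colours.  The edges at x are
-- exactly e_1(x),…,e_n(x) (pairwise distinct), so this says i ↦ f(e_i(x)) is injective.
Proper : ∀ {n k} → EdgeColouring n k → Set
Proper {n} f = ∀ (x : Vertex n) → Injective _≡_ _≡_ (colour f x)

Distinguishing : ∀ {n k} → EdgeColouring n k → Set
Distinguishing f = Injective _≡_ _≡_ (palette f)

HasPDColouring : ℕ → ℕ → Set
HasPDColouring n k = Σ (EdgeColouring n k) (λ f → Proper f × Distinguishing f)

{-# OPTIONS --safe #-}
module Submission where

-- The lower bound holds because a proper colouring uses n distinct colours at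
-- each vertex.  The upper bound comes from pairs of proper colourings of H_n
-- whose 2·2ⁿ palettes are pairwise distinct ("twins").  H_{n+1} is two copies of
-- H_n joined by the edges of the new dimension; colouring the copies by the two
-- twins keeps all palettes distinct.  Giving the new dimension a fresh top colour
-- in one colouring, and colour 0 with all old colours shifted up in the other,
-- yields twins for H_{n+1} with one more colour, told apart by the first palette
-- entry.  Twins for H_5 with 5 colours were found by computer search.

open import Defs
open import Data.Bool using (Bool; true; false)
import Data.Bool.Properties as Bool
open import Data.Empty using (⊥-elim)
open import Data.Fin using (Fin; zero; suc; fromℕ; inject₁; combine; #_)
open import Data.Fin.Properties
  using (_≟_; all?; injective⇒≤; inject₁-injective; suc-injective; fromℕ≢inject₁)
open import Data.Nat using (ℕ; suc; _^_; _+_; _≤_; _<_)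
open import Data.Nat.Properties using (m≤n⇒∃[o]m+o≡n)
open import Data.Product using (_×_; _,_)
open import Data.Vec using (Vec; []; _∷_; lookup; map; replicate; tabulate)
open import Data.Vec.Properties using (∷-injectiveˡ; ∷-injectiveʳ; tabulate-∘; ≡-dec)
open import Function using (_∘_)
open import Function.Definitions using (Injective)
open import Relation.Binary.PropositionalEquality
  using (_≡_; _≢_; refl; sym; cong; cong₂; module ≡-Reasoning)
open import Relation.Binary.Definitions using (DecidableEquality)
open import Relation.Nullary using (Dec)
open import Relation.Nullary.Decidable using (True; map′; _×-dec_; _→-dec_; toWitness)
open import Relation.Unary using (Decidable)

private variable
  n k k′ : ℕ
  A B : Set

map-injective : {f : A → B} → Injective _≡_ _≡_ f → Injective _≡_ _≡_ (map {n = n} f)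
map-injective f-inj {[]}     {[]}     _ = refl
map-injective f-inj {x ∷ xs} {y ∷ ys} e =
  cong₂ _∷_ (f-inj (∷-injectiveˡ e)) (map-injective f-inj (∷-injectiveʳ e))

proper⇒≤ : (f : EdgeColouring n k) → Proper f → n ≤ k
proper⇒≤ f f-proper = injective⇒≤ (f-proper (replicate _ false))

jointPalette : (Bool → EdgeColouring n k) → Vertex (suc n) → Vec (Fin k) n
jointPalette c (b ∷ x) = palette (c b) x

record PDTwins (n k : ℕ) : Set where
  field
    twin                   : Bool → EdgeColouring n k
    proper                 : ∀ b → Proper (twin b)
    jointly-distinguishing : Injective _≡_ _≡_ (jointPalette twin)

  distinguishing : ∀ b → Distinguishing (twin b)
  distinguishing b {x} {y} e = ∷-injectiveʳ (jointly-distinguishing {b ∷ x} {b ∷ y} e)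

  hasPDColouring : HasPDColouring n k
  hasPDColouring = twin false , proper false , distinguishing false

open PDTwins

jointPalette-injective : {c : Bool → EdgeColouring n k} →
  (∀ b → Distinguishing (c b)) →
  (∀ x y → palette (c false) x ≢ palette (c true) y) →
  Injective _≡_ _≡_ (jointPalette c)
jointPalette-injective c-dist disjoint {false ∷ x} {false ∷ y} e = cong (false ∷_) (c-dist false e)
jointPalette-injective c-dist disjoint {true ∷ x}  {true ∷ y}  e = cong (true ∷_) (c-dist true e)
jointPalette-injective c-dist disjoint {false ∷ x} {true ∷ y}  e = ⊥-elim (disjoint x y e)
jointPalette-injective c-dist disjoint {true ∷ x}  {false ∷ y} e = ⊥-elim (disjoint y x (sym e))

extend : (Fin k → Fin k′) → Fin k′ → (Bool → EdgeColouring n k) → EdgeColouring (suc n) k′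
extend {k′ = k′} {n = n} σ new c = record { colour = col ; wellDefd = col-wellDefd }
  where
  col : Vertex (suc n) → Fin (suc n) → Fin k′
  col (b ∷ x) zero    = new
  col (b ∷ x) (suc i) = σ (colour (c b) x i)

  col-wellDefd : ∀ x i → col x i ≡ col (flip i x) i
  col-wellDefd (b ∷ x) zero    = refl
  col-wellDefd (b ∷ x) (suc i) = cong σ (wellDefd (c b) x i)

module _ {σ : Fin k → Fin k′} {new : Fin k′} {c : Bool → EdgeColouring n k}
         (σ-injective : Injective _≡_ _≡_ σ) where

  extend-proper : (∀ a → σ a ≢ new) → (∀ b → Proper (c b)) → Proper (extend σ new c)
  extend-proper new-fresh c-proper (b ∷ x) {zero}  {zero}  _ = refl
  extend-proper new-fresh c-proper (b ∷ x) {zero}  {suc j} e = ⊥-elim (new-fresh _ (sym e))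
  extend-proper new-fresh c-proper (b ∷ x) {suc i} {zero}  e = ⊥-elim (new-fresh _ e)
  extend-proper new-fresh c-proper (b ∷ x) {suc i} {suc j} e =
    cong suc (c-proper b x (σ-injective e))

  extend-distinguishing : Injective _≡_ _≡_ (jointPalette c) → Distinguishing (extend σ new c)
  extend-distinguishing c-joint {b ∷ x} {b′ ∷ y} e =
    c-joint (map-injective σ-injective same-image)
    where
    open ≡-Reasoning
    same-image : map σ (palette (c b) x) ≡ map σ (palette (c b′) y)
    same-image = begin
      map σ (palette (c b) x)         ≡⟨ tabulate-∘ σ (colour (c b) x) ⟨
      tabulate (σ ∘ colour (c b) x)   ≡⟨ ∷-injectiveʳ e ⟩
      tabulate (σ ∘ colour (c b′) y)  ≡⟨ tabulate-∘ σ (colour (c b′) y) ⟩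
      map σ (palette (c b′) y)        ∎

twinStep : PDTwins n (suc k) → PDTwins (suc n) (suc (suc k))
twinStep {n = n} {k = k} T = record
  { twin                   = twin′
  ; proper                 = proper′
  ; jointly-distinguishing = jointPalette-injective distinguishing′ heads-differ
  }
  where
  twin′ : Bool → EdgeColouring (suc n) (suc (suc k))
  twin′ false = extend inject₁ (fromℕ (suc k)) (twin T)
  twin′ true  = extend suc zero (twin T)

  proper′ : ∀ b → Proper (twin′ b)
  proper′ false = extend-proper inject₁-injective (λ _ → fromℕ≢inject₁ ∘ sym) (proper T)
  proper′ true  = extend-proper suc-injective (λ _ ()) (proper T)

  distinguishing′ : ∀ b → Distinguishing (twin′ b)
  distinguishing′ false = extend-distinguishing inject₁-injective (jointly-distinguishing T)
  distinguishing′ true  = extend-distinguishing suc-injective (jointly-distinguishing T)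

  heads-differ : ∀ x y → palette (twin′ false) x ≢ palette (twin′ true) y
  heads-differ (_ ∷ _) (_ ∷ _) ()

allVertices? : ∀ n {P : Vertex n → Set} → Decidable P → Dec (∀ x → P x)
allVertices? 0       P? = map′ (λ { p [] → p }) (λ ∀P → ∀P []) (P? [])
allVertices? (suc n) P? =
  map′ (λ { (p , q) (false ∷ x) → p x ; (p , q) (true ∷ x) → q x })
       (λ ∀P → ∀P ∘ (false ∷_) , ∀P ∘ (true ∷_))
       (allVertices? n (P? ∘ (false ∷_)) ×-dec allVertices? n (P? ∘ (true ∷_)))

wellDefd? : (col : Vertex n → Fin n → Fin k) → Dec (∀ x i → col x i ≡ col (flip i x) i)
wellDefd? col = allVertices? _ λ x → all? λ i → col x i ≟ col (flip i x) i

proper? : (f : EdgeColouring n k) → Dec (Proper f)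
proper? f = allVertices? _ λ x →
  map′ (λ inj {i} {j} → inj i j) (λ inj i j → inj)
       (all? λ i → all? λ j → colour f x i ≟ colour f x j →-dec i ≟ j)

injective? : DecidableEquality A → (f : Vertex n → A) → Dec (Injective _≡_ _≡_ f)
injective? _≟ᴬ_ f = map′ (λ inj {x} {y} → inj x y) (λ inj x y → inj)
  (allVertices? _ λ x → allVertices? _ λ y → f x ≟ᴬ f y →-dec ≡-dec Bool._≟_ x y)

vertexIndex : Vertex n → Fin (2 ^ n)
vertexIndex []      = zero
vertexIndex (b ∷ x) = combine (bit b) (vertexIndex x)
  where
  bit : Bool → Fin 2
  bit false = zero
  bit true  = suc zero

-- Row j of t is the palette of the vertex whose binary expansion, most
-- significant coordinate first, is j.
fromPalettes : (t : Vec (Vec (Fin k) n) (2 ^ n)) →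
  {wd : True (wellDefd? (λ x → lookup (lookup t (vertexIndex x))))} → EdgeColouring n k
fromPalettes t {wd} = record
  { colour   = λ x → lookup (lookup t (vertexIndex x))
  ; wellDefd = toWitness wd
  }

palettes₀ : Vec (Vec (Fin 5) 5) 32
palettes₀ =
  (# 1 ∷ # 4 ∷ # 2 ∷ # 0 ∷ # 3 ∷ []) ∷ (# 0 ∷ # 2 ∷ # 4 ∷ # 1 ∷ # 3 ∷ []) ∷
  (# 4 ∷ # 1 ∷ # 2 ∷ # 0 ∷ # 3 ∷ []) ∷ (# 4 ∷ # 2 ∷ # 0 ∷ # 1 ∷ # 3 ∷ []) ∷
  (# 3 ∷ # 4 ∷ # 2 ∷ # 0 ∷ # 1 ∷ []) ∷ (# 0 ∷ # 2 ∷ # 4 ∷ # 3 ∷ # 1 ∷ []) ∷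
  (# 3 ∷ # 1 ∷ # 2 ∷ # 0 ∷ # 4 ∷ []) ∷ (# 2 ∷ # 1 ∷ # 0 ∷ # 3 ∷ # 4 ∷ []) ∷
  (# 2 ∷ # 4 ∷ # 3 ∷ # 0 ∷ # 1 ∷ []) ∷ (# 0 ∷ # 2 ∷ # 3 ∷ # 4 ∷ # 1 ∷ []) ∷
  (# 2 ∷ # 1 ∷ # 4 ∷ # 0 ∷ # 3 ∷ []) ∷ (# 1 ∷ # 2 ∷ # 0 ∷ # 4 ∷ # 3 ∷ []) ∷
  (# 1 ∷ # 4 ∷ # 3 ∷ # 2 ∷ # 0 ∷ []) ∷ (# 1 ∷ # 2 ∷ # 3 ∷ # 4 ∷ # 0 ∷ []) ∷
  (# 0 ∷ # 1 ∷ # 4 ∷ # 2 ∷ # 3 ∷ []) ∷ (# 2 ∷ # 1 ∷ # 0 ∷ # 4 ∷ # 3 ∷ []) ∷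
  (# 1 ∷ # 0 ∷ # 2 ∷ # 3 ∷ # 4 ∷ []) ∷ (# 0 ∷ # 3 ∷ # 2 ∷ # 1 ∷ # 4 ∷ []) ∷
  (# 4 ∷ # 0 ∷ # 1 ∷ # 3 ∷ # 2 ∷ []) ∷ (# 4 ∷ # 0 ∷ # 3 ∷ # 1 ∷ # 2 ∷ []) ∷
  (# 3 ∷ # 0 ∷ # 2 ∷ # 4 ∷ # 1 ∷ []) ∷ (# 0 ∷ # 3 ∷ # 2 ∷ # 4 ∷ # 1 ∷ []) ∷
  (# 3 ∷ # 2 ∷ # 1 ∷ # 4 ∷ # 0 ∷ []) ∷ (# 2 ∷ # 1 ∷ # 3 ∷ # 4 ∷ # 0 ∷ []) ∷
  (# 2 ∷ # 0 ∷ # 4 ∷ # 3 ∷ # 1 ∷ []) ∷ (# 0 ∷ # 3 ∷ # 4 ∷ # 2 ∷ # 1 ∷ []) ∷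
  (# 2 ∷ # 0 ∷ # 1 ∷ # 3 ∷ # 4 ∷ []) ∷ (# 1 ∷ # 0 ∷ # 3 ∷ # 2 ∷ # 4 ∷ []) ∷
  (# 1 ∷ # 0 ∷ # 4 ∷ # 3 ∷ # 2 ∷ []) ∷ (# 1 ∷ # 3 ∷ # 4 ∷ # 0 ∷ # 2 ∷ []) ∷
  (# 0 ∷ # 2 ∷ # 1 ∷ # 3 ∷ # 4 ∷ []) ∷ (# 2 ∷ # 1 ∷ # 3 ∷ # 0 ∷ # 4 ∷ []) ∷
  []

palettes₁ : Vec (Vec (Fin 5) 5) 32
palettes₁ =
  (# 0 ∷ # 4 ∷ # 2 ∷ # 1 ∷ # 3 ∷ []) ∷ (# 0 ∷ # 4 ∷ # 1 ∷ # 2 ∷ # 3 ∷ []) ∷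
  (# 2 ∷ # 3 ∷ # 0 ∷ # 1 ∷ # 4 ∷ []) ∷ (# 3 ∷ # 1 ∷ # 0 ∷ # 2 ∷ # 4 ∷ []) ∷
  (# 4 ∷ # 1 ∷ # 2 ∷ # 3 ∷ # 0 ∷ []) ∷ (# 4 ∷ # 3 ∷ # 1 ∷ # 2 ∷ # 0 ∷ []) ∷
  (# 1 ∷ # 2 ∷ # 0 ∷ # 3 ∷ # 4 ∷ []) ∷ (# 1 ∷ # 3 ∷ # 0 ∷ # 2 ∷ # 4 ∷ []) ∷
  (# 0 ∷ # 4 ∷ # 3 ∷ # 1 ∷ # 2 ∷ []) ∷ (# 0 ∷ # 4 ∷ # 1 ∷ # 3 ∷ # 2 ∷ []) ∷
  (# 0 ∷ # 3 ∷ # 4 ∷ # 1 ∷ # 2 ∷ []) ∷ (# 0 ∷ # 1 ∷ # 4 ∷ # 3 ∷ # 2 ∷ []) ∷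
  (# 4 ∷ # 1 ∷ # 3 ∷ # 0 ∷ # 2 ∷ []) ∷ (# 4 ∷ # 3 ∷ # 1 ∷ # 0 ∷ # 2 ∷ []) ∷
  (# 3 ∷ # 2 ∷ # 4 ∷ # 0 ∷ # 1 ∷ []) ∷ (# 2 ∷ # 3 ∷ # 4 ∷ # 0 ∷ # 1 ∷ []) ∷
  (# 0 ∷ # 2 ∷ # 3 ∷ # 1 ∷ # 4 ∷ []) ∷ (# 0 ∷ # 1 ∷ # 3 ∷ # 2 ∷ # 4 ∷ []) ∷
  (# 2 ∷ # 3 ∷ # 4 ∷ # 1 ∷ # 0 ∷ []) ∷ (# 3 ∷ # 1 ∷ # 4 ∷ # 2 ∷ # 0 ∷ []) ∷
  (# 4 ∷ # 2 ∷ # 3 ∷ # 0 ∷ # 1 ∷ []) ∷ (# 4 ∷ # 0 ∷ # 3 ∷ # 2 ∷ # 1 ∷ []) ∷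
  (# 1 ∷ # 2 ∷ # 4 ∷ # 0 ∷ # 3 ∷ []) ∷ (# 1 ∷ # 0 ∷ # 4 ∷ # 2 ∷ # 3 ∷ []) ∷
  (# 0 ∷ # 2 ∷ # 1 ∷ # 4 ∷ # 3 ∷ []) ∷ (# 0 ∷ # 1 ∷ # 2 ∷ # 4 ∷ # 3 ∷ []) ∷
  (# 0 ∷ # 3 ∷ # 1 ∷ # 4 ∷ # 2 ∷ []) ∷ (# 0 ∷ # 1 ∷ # 3 ∷ # 4 ∷ # 2 ∷ []) ∷
  (# 4 ∷ # 2 ∷ # 1 ∷ # 0 ∷ # 3 ∷ []) ∷ (# 4 ∷ # 0 ∷ # 2 ∷ # 1 ∷ # 3 ∷ []) ∷
  (# 3 ∷ # 2 ∷ # 1 ∷ # 0 ∷ # 4 ∷ []) ∷ (# 2 ∷ # 0 ∷ # 3 ∷ # 1 ∷ # 4 ∷ []) ∷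
  []

twins₅ : PDTwins 5 5
twins₅ = record
  { twin                   = twin₅
  ; proper                 = λ { false → toWitness {a? = proper? (twin₅ false)} _
                               ; true  → toWitness {a? = proper? (twin₅ true)} _ }
  ; jointly-distinguishing =
      toWitness {a? = injective? (≡-dec _≟_) (jointPalette twin₅)} _
  }
  where
  twin₅ : Bool → EdgeColouring 5 5
  twin₅ false = fromPalettes palettes₀
  twin₅ true  = fromPalettes palettes₁

pdTwins : ∀ m → PDTwins (5 + m) (5 + m)
pdTwins 0       = twins₅
pdTwins (suc m) = twinStep (pdTwins m)

theorem4 : (n : ℕ) → 5 ≤ n →
    HasPDColouring n n × (∀ (k : ℕ) → 0 < k → HasPDColouring n k → n ≤ k)
theorem4 n 5≤n with m≤n⇒∃[o]m+o≡n 5≤n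
... | m , refl = hasPDColouring (pdTwins m) , λ _ _ (f , f-proper , _) → proper⇒≤ f f-proper
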